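{- Let $T_1,T_2$ be planar rooted trees, each with $n$ non-root nodes, and let $R_1=\rho(T_1)$, $R_2=\rho(T_2)$. Then $T_1\leq_T T_2$ if and only if, for every $k\in\{1,\dots,n\}$, $|R_1(k)|\geq|R_2(k)|$.
   Context: In a planar (ordered) rooted tree the nodes are labelled by the preorder traversal (root first, then recursively the subtrees of its children from left to right), the root getting label $0$ and the non-root nodes labels $1,\dots,n$; nodes of different trees are identified via their labels. For such a tree $T$, $\rho(T)$ is the strict partial order $R$ on $\{1,\dots,n\}$ with $xRy$ iff neither of $x,y$ is an ancestor of the other and $x$ lies to the left of $y$ in $T$. For a relation $R$, $R(k)=\{y: kRy\}$. For a node $k$, $u_T(k)$ denotes the set of (proper) descendants of $k$. The Tamari order: $T_1\leq_T T_2$ iff $|u_{T_1}(k)|\leq|u_{T_2}(k)|$ for every node $k$. -}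

module Defs where

open import Data.Nat using (ℕ; zero; suc; _+_; _≤_; _<ᵇ_; _≡ᵇ_)
open import Data.Bool using (Bool; true; false; not; _∧_; if_then_else_)
open import Data.List using (List; []; _∷_; map; _++_; upTo)

data Tree : Set where
  node : List Tree → Tree

mutual
  size : Tree → ℕ
  size (node ts) = sizeF ts

  sizeF : List Tree → ℕ
  sizeF [] = 0
  sizeF (t ∷ ts) = suc (size t + sizeF ts)

-- Address of a node: the list of child indices on the path from the root.
Addr : Set
Addr = List ℕ

-- Addresses of all nodes in preorder (root first, then children's subtrees
-- from left to right).  The node with label k is the k-th entry.
mutual
  preorder : Tree → List Addr
  preorder (node ts) = [] ∷ preorderF 0 ts

  preorderF : ℕ → List Tree → List Addr
  preorderF i [] = []
  preorderF i (t ∷ ts) = map (i ∷_) (preorder t) ++ preorderF (suc i) ts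

nth : ℕ → List Addr → Addr
nth _ [] = []
nth zero (a ∷ _) = a
nth (suc k) (_ ∷ as) = nth k as

-- Address of the node with preorder label k (only meaningful for k ≤ size T).
addr : Tree → ℕ → Addr
addr T k = nth k (preorder T)

properPrefix : Addr → Addr → Bool
properPrefix [] [] = false
properPrefix [] (_ ∷ _) = true
properPrefix (_ ∷ _) [] = false
properPrefix (a ∷ as) (b ∷ bs) = (a ≡ᵇ b) ∧ properPrefix as bs

leftAddr : Addr → Addr → Bool
leftAddr (a ∷ as) (b ∷ bs) = if a ≡ᵇ b then leftAddr as bs else a <ᵇ b
leftAddr _ _ = false

isAncestor : Tree → ℕ → ℕ → Bool
isAncestor T x y = properPrefix (addr T x) (addr T y)

rho : Tree → ℕ → ℕ → Bool
rho T x y = not (isAncestor T x y) ∧ not (isAncestor T y x)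
            ∧ leftAddr (addr T x) (addr T y)

count : (ℕ → Bool) → List ℕ → ℕ
count p [] = 0
count p (x ∷ xs) = if p x then suc (count p xs) else count p xs

nonRootLabels : ℕ → List ℕ
nonRootLabels n = map suc (upTo n)

allLabels : ℕ → List ℕ
allLabels n = upTo (suc n)

cardRho : Tree → ℕ → ℕ
cardRho T k = count (rho T k) (nonRootLabels (size T))

-- |u_T(k)|: number of proper descendants of node k.
cardDesc : Tree → ℕ → ℕ
cardDesc T k = count (isAncestor T k) (allLabels (size T))

-- Tamari order: |u_{T1}(k)| ≤ |u_{T2}(k)| for every node k (labels 0..n).
_≤T_ : Tree → Tree → Set
T₁ ≤T T₂ = ∀ k → k ≤ size T₁ → cardDesc T₁ k ≤ cardDesc T₂ k

-- Preorder labels the nodes in strictly increasing lexicographic order of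
-- their addresses. So a label y lies after k exactly when the node y is a
-- proper descendant of k or lies to the right of k, and never both; hence
-- |R(k)| + |u(k)| = n − k for every tree with n non-root nodes, so for two
-- trees of the same size comparing |u(k)| is the same as comparing |R(k)| in
-- the opposite direction; at the root k = 0 both R(0) are empty.
module Submission where

open import Defs
open import Data.Bool using (Bool; true; false; not; _∧_; T)
open import Data.Bool.Properties using (∧-zeroʳ; T-≡; T-∧)
open import Data.Empty using (⊥-elim)
open import Data.List using ([]; _∷_; [_]; map; _++_; length; upTo)
open import Data.List.Properties using (length-++; length-map; map-++; map-upTo; upTo-∷ʳ)
open import Data.List.Relation.Unary.All as All using (All; []; _∷_)
import Data.List.Relation.Unary.All.Properties as All
open import Data.List.Relation.Unary.AllPairs as AllPairs using (AllPairs; []; _∷_)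
import Data.List.Relation.Unary.AllPairs.Properties as AllPairs
open import Data.List.Relation.Binary.Lex.Strict using (Lex-<; halt; this; next; <-asymmetric)
open import Data.Nat using (ℕ; zero; suc; _+_; _∸_; _≤_; _<_; _≡ᵇ_; _<ᵇ_; z≤n; s≤s; s≤s⁻¹; s<s)
open import Data.Nat.Properties using (<-resp₂-≡; <-asym; ≡ᵇ⇒≡; ≡⇒≡ᵇ; <ᵇ⇒<; <⇒<ᵇ; <⇒≢; ≤-refl; <⇒≤; <-cmp; 0∸n≡0; +-comm; +-∸-comm; +-identityʳ; m≤n⇒m∸n≡0; ≮⇒≥; +-cancelʳ-≤; +-monoʳ-≤; ≤-reflexive; ≤-trans; +-commutativeSemigroup)
open import Data.Product using (_,_)
open import Data.Sum using (_⊎_; inj₁; inj₂; [_,_]′)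
open import Function.Base using (id)
open import Function.Bundles using (_⇔_; mk⇔; Equivalence)
open import Relation.Binary.Definitions using (tri<; tri≈; tri>)
open import Relation.Binary.PropositionalEquality using (_≡_; refl; sym; trans; cong; cong₂; subst; module ≡-Reasoning)
open import Relation.Nullary using (¬_; contradiction)
open import Algebra.Properties.CommutativeSemigroup +-commutativeSemigroup using (interchange)

open Equivalence using (to; from)
open ≡-Reasoning

indicator : Bool → ℕ
indicator true  = 1
indicator false = 0

<ᵇ≡true⇒< : ∀ m n → (m <ᵇ n) ≡ true → m < n
<ᵇ≡true⇒< m n m<ᵇn = <ᵇ⇒< m n (from T-≡ m<ᵇn)

<ᵇ≡false⇒≮ : ∀ m n → (m <ᵇ n) ≡ false → ¬ m < n
<ᵇ≡false⇒≮ m n m≮ᵇn m<n = subst T m≮ᵇn (<⇒<ᵇ m<n)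

count-∷ : ∀ p x xs → count p (x ∷ xs) ≡ indicator (p x) + count p xs
count-∷ p x xs with p x
... | true  = refl
... | false = refl

count-++ : ∀ p xs ys → count p (xs ++ ys) ≡ count p xs + count p ys
count-++ p []       ys = refl
count-++ p (x ∷ xs) ys with p x
... | true  = cong suc (count-++ p xs ys)
... | false = count-++ p xs ys

count-+ : ∀ p q r xs → All (λ x → indicator (p x) + indicator (q x) ≡ indicator (r x)) xs →
  count p xs + count q xs ≡ count r xs
count-+ p q r []       []       = refl
count-+ p q r (x ∷ xs) (e ∷ es) = begin
  count p (x ∷ xs) + count q (x ∷ xs)
    ≡⟨ cong₂ _+_ (count-∷ p x xs) (count-∷ q x xs) ⟩
  (indicator (p x) + count p xs) + (indicator (q x) + count q xs)
    ≡⟨ interchange (indicator (p x)) (count p xs) (indicator (q x)) (count q xs) ⟩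
  (indicator (p x) + indicator (q x)) + (count p xs + count q xs)
    ≡⟨ cong₂ _+_ e (count-+ p q r xs es) ⟩
  indicator (r x) + count r xs
    ≡⟨ count-∷ r x xs ⟨
  count r (x ∷ xs) ∎

count-false : ∀ p xs → (∀ x → p x ≡ false) → count p xs ≡ 0
count-false p []       _     = refl
count-false p (x ∷ xs) p≡false rewrite p≡false x = count-false p xs p≡false

count-above : ∀ k n → count (k <ᵇ_) (nonRootLabels n) ≡ n ∸ k
count-above k zero    = sym (0∸n≡0 k)
count-above k (suc n) = begin
  count above (map suc (upTo (suc n)))
    ≡⟨ cong (count above) (trans (sym (cong (map suc) (upTo-∷ʳ n))) (map-++ suc (upTo n) [ n ])) ⟩
  count above (nonRootLabels n ++ [ suc n ])
    ≡⟨ count-++ above (nonRootLabels n) [ suc n ] ⟩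
  count above (nonRootLabels n) + count above [ suc n ]
    ≡⟨ cong (_+ count above [ suc n ]) (count-above k n) ⟩
  n ∸ k + count above [ suc n ]
    ≡⟨ add-last ⟩
  suc n ∸ k ∎
  where
  above : ℕ → Bool
  above = k <ᵇ_

  add-last : n ∸ k + count above [ suc n ] ≡ suc n ∸ k
  add-last with k <ᵇ suc n in k<ᵇ1+n
  ... | true  = sym (trans (cong (_∸ k) (+-comm 1 n))
                           (+-∸-comm 1 (s≤s⁻¹ (<ᵇ≡true⇒< k (suc n) k<ᵇ1+n))))
  ... | false = begin
    n ∸ k + 0  ≡⟨ +-identityʳ (n ∸ k) ⟩
    n ∸ k      ≡⟨ m≤n⇒m∸n≡0 (<⇒≤ (≮⇒≥ (<ᵇ≡false⇒≮ k (suc n) k<ᵇ1+n))) ⟩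
    0          ≡⟨ m≤n⇒m∸n≡0 (≮⇒≥ (<ᵇ≡false⇒≮ k (suc n) k<ᵇ1+n)) ⟨
    suc n ∸ k  ∎

m+n≡o+p⇒n≤p⇒o≤m : ∀ {m n o p} → m + n ≡ o + p → n ≤ p → o ≤ m
m+n≡o+p⇒n≤p⇒o≤m {m} {n} {o} eq n≤p =
  +-cancelʳ-≤ n o m (≤-trans (+-monoʳ-≤ o n≤p) (≤-reflexive (sym eq)))

m+n≡o+p⇒n≤p⇔o≤m : ∀ {m n o p} → m + n ≡ o + p → (n ≤ p) ⇔ (o ≤ m)
m+n≡o+p⇒n≤p⇔o≤m {m} {n} {o} {p} eq = mk⇔ (m+n≡o+p⇒n≤p⇒o≤m eq)
  (m+n≡o+p⇒n≤p⇒o≤m (trans (+-comm p o) (trans (sym eq) (+-comm m n))))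

nth-All : ∀ {P : Addr → Set} {as} i → All P as → i < length as → P (nth i as)
nth-All zero    (p ∷ _)  _         = p
nth-All (suc i) (_ ∷ ps) (s<s i<n) = nth-All i ps i<n

nth-AllPairs : ∀ {R : Addr → Addr → Set} {as i j} → AllPairs R as →
  i < j → j < length as → R (nth i as) (nth j as)
nth-AllPairs {i = zero}  {suc j} (r ∷ _)  _         (s<s j<n) = nth-All j r j<n
nth-AllPairs {i = suc i} {suc j} (_ ∷ rs) (s<s i<j) (s<s j<n) = nth-AllPairs rs i<j j<n

-- The strict lexicographic order of addresses; it is the order in which a
-- preorder traversal visits the nodes.
_≺_ : Addr → Addr → Set
_≺_ = Lex-< _≡_ _<_

≺-asym : ∀ {a b} → a ≺ b → ¬ b ≺ a
≺-asym = <-asymmetric sym <-resp₂-≡ <-asym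

≺-irrefl : ∀ {a} → ¬ a ≺ a
≺-irrefl a≺a = ≺-asym a≺a a≺a

properPrefix⇒≺ : ∀ a b → T (properPrefix a b) → a ≺ b
properPrefix⇒≺ [] (_ ∷ _) _ = halt
properPrefix⇒≺ (i ∷ a) (j ∷ b) prefix with to T-∧ prefix
... | i≡ᵇj , a⊏b = next (≡ᵇ⇒≡ i j i≡ᵇj) (properPrefix⇒≺ a b a⊏b)

leftAddr⇒≺ : ∀ a b → T (leftAddr a b) → a ≺ b
leftAddr⇒≺ (i ∷ a) (j ∷ b) left with i ≡ᵇ j in i≡ᵇj
... | true  = next (≡ᵇ⇒≡ i j (from T-≡ i≡ᵇj)) (leftAddr⇒≺ a b left)
... | false = this (<ᵇ⇒< i j left)

≺⇒properPrefix⊎leftAddr : ∀ {a b} → a ≺ b → T (properPrefix a b) ⊎ T (leftAddr a b)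
≺⇒properPrefix⊎leftAddr halt = inj₁ _
≺⇒properPrefix⊎leftAddr (this {i} {_} {j} i<j) with i ≡ᵇ j in i≡ᵇj
... | true  = contradiction (≡ᵇ⇒≡ i j (from T-≡ i≡ᵇj)) (<⇒≢ i<j)
... | false = inj₂ (<⇒<ᵇ i<j)
≺⇒properPrefix⊎leftAddr (next {i} refl a≺b)
  rewrite to T-≡ (≡⇒≡ᵇ i i refl) = ≺⇒properPrefix⊎leftAddr a≺b

-- rho T x y unfolds to leftOf (addr T x) (addr T y).
leftOf : Addr → Addr → Bool
leftOf a b = not (properPrefix a b) ∧ not (properPrefix b a) ∧ leftAddr a b

leftOf+properPrefix-≺ : ∀ {a b} → a ≺ b →
  indicator (leftOf a b) + indicator (properPrefix a b) ≡ 1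
leftOf+properPrefix-≺ {a} {b} a≺b
  with properPrefix a b in a⊏b | properPrefix b a in b⊏a | leftAddr a b in a◁b
... | true  | _    | _     = refl
... | false | true | _     = contradiction (properPrefix⇒≺ b a (from T-≡ b⊏a)) (≺-asym a≺b)
... | false | false | true = refl
... | false | false | false =
  ⊥-elim ([ subst T a⊏b , subst T a◁b ]′ (≺⇒properPrefix⊎leftAddr a≺b))

leftOf+properPrefix-⊀ : ∀ {a b} → ¬ a ≺ b →
  indicator (leftOf a b) + indicator (properPrefix a b) ≡ 0
leftOf+properPrefix-⊀ {a} {b} a⊀b with properPrefix a b in a⊏b | leftAddr a b in a◁b
... | true  | _    = contradiction (properPrefix⇒≺ a b (from T-≡ a⊏b)) a⊀b
... | false | true = contradiction (leftAddr⇒≺ a b (from T-≡ a◁b)) a⊀b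
... | false | false rewrite ∧-zeroʳ (not (properPrefix b a)) = refl

preorderF-heads : ∀ {P : Addr → Set} i ts → (∀ {j} c → i ≤ j → P (j ∷ c)) →
  All P (preorderF i ts)
preorderF-heads i []       _       = []
preorderF-heads i (t ∷ ts) P-heads = All.++⁺
  (All.map⁺ (All.universal (λ c → P-heads c ≤-refl) (preorder t)))
  (preorderF-heads (suc i) ts (λ c i<j → P-heads c (<⇒≤ i<j)))

mutual
  preorder-sorted : ∀ t → AllPairs _≺_ (preorder t)
  preorder-sorted (node ts) = preorderF-heads 0 ts (λ _ _ → halt) ∷ preorderF-sorted 0 ts

  preorderF-sorted : ∀ i ts → AllPairs _≺_ (preorderF i ts)
  preorderF-sorted i []       = []
  preorderF-sorted i (t ∷ ts) = AllPairs.++⁺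
    (AllPairs.map⁺ (AllPairs.map (next refl) (preorder-sorted t)))
    (preorderF-sorted (suc i) ts)
    (All.map⁺ (All.universal (λ _ → preorderF-heads (suc i) ts (λ _ → this)) (preorder t)))

mutual
  length-preorder : ∀ t → length (preorder t) ≡ suc (size t)
  length-preorder (node ts) = cong suc (length-preorderF 0 ts)

  length-preorderF : ∀ i ts → length (preorderF i ts) ≡ sizeF ts
  length-preorderF i []       = refl
  length-preorderF i (t ∷ ts) = begin
    length (map (i ∷_) (preorder t) ++ preorderF (suc i) ts)
      ≡⟨ length-++ (map (i ∷_) (preorder t)) ⟩
    length (map (i ∷_) (preorder t)) + length (preorderF (suc i) ts)
      ≡⟨ cong₂ _+_ (trans (length-map (i ∷_) (preorder t)) (length-preorder t))
                   (length-preorderF (suc i) ts) ⟩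
    suc (size t) + sizeF ts ∎

addr-monotone : ∀ T {i j} → i < j → j ≤ size T → addr T i ≺ addr T j
addr-monotone T i<j j≤n =
  nth-AllPairs (preorder-sorted T) i<j (subst (_ <_) (sym (length-preorder T)) (s≤s j≤n))

addr-reflects : ∀ T {i j} → i ≤ size T → ¬ i < j → ¬ addr T i ≺ addr T j
addr-reflects T {i} {j} i≤n i≮j with <-cmp i j
... | tri< i<j _ _  = contradiction i<j i≮j
... | tri≈ _ refl _ = ≺-irrefl
... | tri> _ _ j<i  = ≺-asym (addr-monotone T j<i i≤n)

leftOf+descendant : ∀ T {k y} → k ≤ size T → y ≤ size T →
  indicator (rho T k y) + indicator (isAncestor T k y) ≡ indicator (k <ᵇ y)
leftOf+descendant T {k} {y} k≤n y≤n with k <ᵇ y in k<ᵇy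
... | true  = leftOf+properPrefix-≺ (addr-monotone T (<ᵇ≡true⇒< k y k<ᵇy) y≤n)
... | false = leftOf+properPrefix-⊀ (addr-reflects T k≤n (<ᵇ≡false⇒≮ k y k<ᵇy))

properPrefix-[] : ∀ a → properPrefix a [] ≡ false
properPrefix-[] []      = refl
properPrefix-[] (_ ∷ _) = refl

cardDesc-nonRoot : ∀ T k → cardDesc T k ≡ count (isAncestor T k) (nonRootLabels (size T))
cardDesc-nonRoot (node ts) k
  rewrite map-upTo suc (sizeF ts) | properPrefix-[] (addr (node ts) k) = refl

cardRho+cardDesc : ∀ T {k} → k ≤ size T → cardRho T k + cardDesc T k ≡ size T ∸ k
cardRho+cardDesc T {k} k≤n = begin
  cardRho T k + cardDesc T k
    ≡⟨ cong (cardRho T k +_) (cardDesc-nonRoot T k) ⟩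
  count (rho T k) labels + count (isAncestor T k) labels
    ≡⟨ count-+ (rho T k) (isAncestor T k) _ labels
         (All.map⁺ (All.applyUpTo⁺₁ id (size T) (leftOf+descendant T k≤n))) ⟩
  count (k <ᵇ_) labels
    ≡⟨ count-above k (size T) ⟩
  size T ∸ k ∎
  where labels = nonRootLabels (size T)

cardRho-root : ∀ T → cardRho T 0 ≡ 0
cardRho-root T@(node _) = count-false (rho T 0) (nonRootLabels (size T))
  (λ y → trans (cong (not (isAncestor T 0 y) ∧_) (∧-zeroʳ _)) (∧-zeroʳ _))

mainTheorem9 : (n : ℕ) (T₁ T₂ : Tree) → size T₁ ≡ n → size T₂ ≡ n →
    (T₁ ≤T T₂) ⇔ (∀ k → 1 ≤ k → k ≤ n → cardRho T₂ k ≤ cardRho T₁ k)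
mainTheorem9 _ T₁ T₂ refl size₂ = mk⇔
  (λ desc≤ k _ k≤n → to (desc≤⇔rho≥ k≤n) (desc≤ k k≤n))
  (λ { rho≥ zero    _   → from (desc≤⇔rho≥ z≤n)
                             (≤-reflexive (trans (cardRho-root T₂) (sym (cardRho-root T₁))))
     ; rho≥ (suc k) k≤n → from (desc≤⇔rho≥ k≤n) (rho≥ (suc k) (s≤s z≤n) k≤n) })
  where
  desc≤⇔rho≥ : ∀ {k} → k ≤ size T₁ → (cardDesc T₁ k ≤ cardDesc T₂ k) ⇔ (cardRho T₂ k ≤ cardRho T₁ k)
  desc≤⇔rho≥ {k} k≤n = m+n≡o+p⇒n≤p⇔o≤m (begin
    cardRho T₁ k + cardDesc T₁ k  ≡⟨ cardRho+cardDesc T₁ k≤n ⟩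
    size T₁ ∸ k                   ≡⟨ cong (_∸ k) size₂ ⟨
    size T₂ ∸ k                   ≡⟨ cardRho+cardDesc T₂ (subst (k ≤_) (sym size₂) k≤n) ⟨
    cardRho T₂ k + cardDesc T₂ k  ∎)
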